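{- Let $\mathcal{G}=(V_\mathcal{G},E^+_\mathcal{G},E^-_\mathcal{G},L_\mathcal{G})$ be a signed graph with $V_\mathcal{G}=[n]$ and let $\omega$ be an edge ordering of $\mathcal{G}$. Then there exist inversion transpositions $\nu_1,\dots,\nu_r\in\mathfrak{H}_n$ such that $\pi_\omega=\nu_1\cdots\nu_r\,\pi_{\varphi(\omega)}$ and $r\equiv|L_\mathcal{G}|\pmod 2$.
   Context: $[n]=\{1,\dots,n\}$, $I_n=\{ -n,\dots,-1,1,\dots,n\}$, $\mathfrak{H}_n=\{\eta\in\mathfrak{S}_{I_n}:\eta(-i)=-\eta(i)\ \forall i\in I_n\}$, with $\mathfrak{S}_n$ regarded as a subgroup of $\mathfrak{H}_n$. For distinct $i,j\in[n]$: $(i\ j)$ swaps $i\leftrightarrow j$, $-i\leftrightarrow -j$; $(i\ { -j})$ sends $i\mapsto -j$, $j\mapsto -i$ (and correspondingly on negatives); for $i\in[n]$ the inversion transposition $(i\ { -i})$ swaps $i\leftrightarrow -i$; each fixes everything else. A signed graph is $\mathcal{G}=(V_\mathcal{G},E^+_\mathcal{G},E^-_\mathcal{G},L_\mathcal{G})$ with $V_\mathcal{G}=[n]$, $E^\pm_\mathcal{G}$ sets of 2-element subsets of $[n]$, $L_\mathcal{G}\subseteq[n]$ (loops); $E_\mathcal{G}=E^+_\mathcal{G}\sqcup E^-_\mathcal{G}\sqcup L_\mathcal{G}$. Set $\tau_e=(i\ j)$ for $e=\{i,j\}\in E^+_\mathcal{G}$, $\tau_e=(i\ { -j})$ for $e=\{i,j\}\in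 E^-_\mathcal{G}$, $\tau_e=(i\ { -i})$ for $e=i\in L_\mathcal{G}$. For an edge ordering (linear order) $\omega=(e_1,\dots,e_m)$ of $E_\mathcal{G}$, $\pi_\omega=\tau_{e_m}\cdots\tau_{e_1}$. $\varphi(\omega)$ is the sequence obtained from $\omega$ by deleting the loops; it is an edge ordering of the unsigned multigraph $\bar{\mathcal{G}}$ (vertex set $[n]$, edges $E^+_\mathcal{G}\sqcup E^-_\mathcal{G}$), and for an edge ordering $(f_1,\dots,f_k)$ of $\bar{\mathcal{G}}$ one sets $\pi_{(f_1,\dots,f_k)}=(a_k\ b_k)\cdots(a_1\ b_1)\in\mathfrak{S}_n\subseteq\mathfrak{H}_n$ where $f_t=\{a_t,b_t\}$. -}

module Defs where

open import Data.Nat using (ℕ; zero; suc)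
open import Data.Bool using (Bool; true; false; not)
open import Data.Fin using (Fin; _<_; _≟_)
open import Data.Fin.Subset using (Subset) renaming (_∈_ to _∈ₛ_)
open import Data.Product using (_×_; _,_)
open import Data.List using (List; []; _∷_; foldr)
open import Data.List.Relation.Unary.Unique.Propositional using (Unique)
open import Data.List.Membership.Propositional using (_∈_)
open import Relation.Binary.PropositionalEquality using (_≡_)
open import Relation.Nullary using (yes; no)
open import Function using (_∘_; id; _⇔_)

-- Elements of I_n: (s , i) stands for i (s = false) or -i (s = true),
-- with i : Fin n standing for the vertex i+1 ∈ [n].
I : ℕ → Set
I n = Bool × Fin n

-- Maps I_n → I_n; elements of 𝔥_n are represented by their action.
-- Products are composition: (σ τ)(x) = σ (τ x).
SPerm : ℕ → Set
SPerm n = I n → I n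

posT : ∀ {n} → Fin n → Fin n → SPerm n
posT i j (s , k) with k ≟ i | k ≟ j
... | yes _ | _     = (s , j)
... | no _  | yes _ = (s , i)
... | no _  | no _  = (s , k)

negT : ∀ {n} → Fin n → Fin n → SPerm n
negT i j (s , k) with k ≟ i | k ≟ j
... | yes _ | _     = (not s , j)
... | no _  | yes _ = (not s , i)
... | no _  | no _  = (s , k)

invT : ∀ {n} → Fin n → SPerm n
invT i (s , k) with k ≟ i
... | yes _ = (not s , k)
... | no _  = (s , k)

-- Edges of a signed graph on [n]: an edge {i,j} (i ≠ j) is stored
-- canonically with i < j; loops are single vertices.
data Edge (n : ℕ) : Set where
  pos  : (i j : Fin n) → .(i < j) → Edge n
  neg  : (i j : Fin n) → .(i < j) → Edge n
  loop : (i : Fin n) → Edge n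

-- A signed graph on [n]: E⁺ and E⁻ given by their indicator on pairs
-- (only pairs i < j are relevant), L ⊆ [n] the set of loops.
record SignedGraph (n : ℕ) : Set where
  field
    E⁺ : Fin n → Fin n → Bool
    E⁻ : Fin n → Fin n → Bool
    L  : Subset n

open SignedGraph public

_∈E_ : ∀ {n} → Edge n → SignedGraph n → Set
pos i j _ ∈E G = E⁺ G i j ≡ true
neg i j _ ∈E G = E⁻ G i j ≡ true
loop i    ∈E G = i ∈ₛ L G

-- An edge ordering (linear order) of E_𝒢: a duplicate-free list
-- enumerating exactly the edges of 𝒢.
record EdgeOrdering {n : ℕ} (G : SignedGraph n) : Set where
  field
    seq      : List (Edge n)
    unique   : Unique seq
    complete : ∀ e → (e ∈ seq) ⇔ (e ∈E G)

open EdgeOrdering public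

τ : ∀ {n} → Edge n → SPerm n
τ (pos i j _) = posT i j
τ (neg i j _) = negT i j
τ (loop i)    = invT i

πseq : ∀ {n} → List (Edge n) → SPerm n
πseq []       = id
πseq (e ∷ es) = πseq es ∘ τ e

π : ∀ {n} {G : SignedGraph n} → EdgeOrdering G → SPerm n
π ω = πseq (seq ω)

-- φ: delete loops; the result is an edge ordering of the unsigned
-- multigraph 𝒢̄, each edge recorded as its pair of endpoints {a,b}.
φ : ∀ {n} → List (Edge n) → List (Fin n × Fin n)
φ []               = []
φ (pos i j _ ∷ es) = (i , j) ∷ φ es
φ (neg i j _ ∷ es) = (i , j) ∷ φ es
φ (loop i ∷ es)    = φ es

πU : ∀ {n} → List (Fin n × Fin n) → SPerm n
πU []             = id
πU ((a , b) ∷ fs) = πU fs ∘ posT a b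

invProd : ∀ {n} → List (Fin n) → SPerm n
invProd = foldr (λ i f → invT i ∘ f) id

module Submission where

-- A loop contributes τ = (i -i), and a negative edge τ = (i -j) = (i -i)(j -j)(i j).
-- Conjugating an inversion transposition by σ ∈ 𝔖_n gives the inversion
-- transposition (σ(i) -σ(i)), so in π_ω every inversion can be moved to the left
-- past the transpositions of the later edges, leaving π_φ(ω) on the right.  This
-- produces |L| + 2|E⁻| inversion transpositions.

open import Defs
open import Data.Nat using (ℕ; suc; _%_; _+_; _*_)
open import Data.Nat.Properties using (+-comm; +-assoc)
open import Data.Nat.DivMod using ([m+kn]%n≡m%n)
open import Data.Bool using (not)
open import Data.Fin using (Fin; zero; suc; _≟_; _<?_)
open import Data.Fin.Properties using (<⇒≢; suc-injective)
open import Data.Fin.Permutation using (Permutation′; _⟨$⟩ʳ_; _∘ₚ_; transpose)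
import Data.Fin.Permutation as Permutation
open import Data.Fin.Subset using (Subset; inside; outside; ∣_∣) renaming (_∈_ to _∈ₛ_)
open import Data.Fin.Subset.Properties using (drop-there)
import Data.Vec.Base as Vec
open Vec using ([]; _∷_)
open import Data.List using (List; []; _∷_; _++_; [_]; length; map; filter)
open import Data.List.Properties using (length-++; length-map)
open import Data.List.Membership.Propositional using (_∈_; _∉_)
open import Data.List.Membership.Propositional.Properties using (∈-map⁺; ∈-map⁻; ∈-filter⁺; ∈-filter⁻)
open import Data.List.Membership.Propositional.Properties.WithK using (unique∧set⇒bag)
open import Data.List.Relation.Unary.Any using (here; there)
open import Data.List.Relation.Unary.All.Properties using (¬Any⇒All¬)
open import Data.List.Relation.Unary.AllPairs using ([]; _∷_)
open import Data.List.Relation.Unary.Unique.Propositional using (Unique)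
import Data.List.Relation.Unary.Unique.Propositional.Properties as Unique
open import Data.List.Relation.Binary.BagAndSetEquality using (∼bag⇒↭)
open import Data.List.Relation.Binary.Permutation.Propositional.Properties using (↭-length)
open import Data.Product using (∃-syntax; _×_; _,_)
open import Data.Empty using (⊥-elim)
open import Function using (_∘_; _⇔_; mk⇔; Equivalence; Injection)
open import Function.Properties.Inverse using (↔⇒↣)
open import Relation.Binary.PropositionalEquality using (_≡_; _≢_; _≗_; refl; sym; trans; cong; module ≡-Reasoning)
open import Relation.Nullary using (yes; no)
open import Relation.Nullary.Decidable using (recompute)
open import Relation.Unary using (Decidable)

open ≡-Reasoning

unique∧set⇒length≡ : ∀ {a} {A : Set a} {xs ys : List A} → Unique xs → Unique ys →
                     (∀ {x} → (x ∈ xs) ⇔ (x ∈ ys)) → length xs ≡ length ys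
unique∧set⇒length≡ u v eq = ↭-length (∼bag⇒↭ (unique∧set⇒bag u v eq))

∈-map-suc⁻ : ∀ {n} {i : Fin n} {xs : List (Fin n)} → suc i ∈ map suc xs → i ∈ xs
∈-map-suc⁻ q with ∈-map⁻ suc q
... | _ , j∈xs , refl = j∈xs

zero∉map-suc : ∀ {n} {xs : List (Fin n)} → zero ∉ map suc xs
zero∉map-suc q with ∈-map⁻ suc q
... | _ , _ , ()

members : ∀ {n} → Subset n → List (Fin n)
members []            = []
members (inside ∷ p)  = zero ∷ map suc (members p)
members (outside ∷ p) = map suc (members p)

length-members : ∀ {n} (p : Subset n) → length (members p) ≡ ∣ p ∣
length-members []            = refl
length-members (inside ∷ p)  = cong suc (trans (length-map suc (members p)) (length-members p))
length-members (outside ∷ p) = trans (length-map suc (members p)) (length-members p)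

members-unique : ∀ {n} (p : Subset n) → Unique (members p)
members-unique []            = []
members-unique (inside ∷ p)  = ¬Any⇒All¬ _ zero∉map-suc ∷ Unique.map⁺ suc-injective (members-unique p)
members-unique (outside ∷ p) = Unique.map⁺ suc-injective (members-unique p)

∈-members : ∀ {n} (p : Subset n) {i} → (i ∈ members p) ⇔ (i ∈ₛ p)
∈-members (inside ∷ p) {zero} = mk⇔ (λ _ → Vec.here) (λ _ → here refl)
∈-members (inside ∷ p) {suc i} =
  mk⇔ (λ { (here ()) ; (there q) → Vec.there (Equivalence.to (∈-members p) (∈-map-suc⁻ q)) })
      (λ q → there (∈-map⁺ suc (Equivalence.from (∈-members p) (drop-there q))))
∈-members (outside ∷ p) {zero} = mk⇔ (⊥-elim ∘ zero∉map-suc) (λ ())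
∈-members (outside ∷ p) {suc i} =
  mk⇔ (Vec.there ∘ Equivalence.to (∈-members p) ∘ ∈-map-suc⁻)
      (∈-map⁺ suc ∘ Equivalence.from (∈-members p) ∘ drop-there)

unsigned : ∀ {n} → Permutation′ n → SPerm n
unsigned σ (s , k) = (s , σ ⟨$⟩ʳ k)

transpositions : ∀ {n} → List (Fin n × Fin n) → Permutation′ n
transpositions []             = Permutation.id
transpositions ((a , b) ∷ fs) = transpose a b ∘ₚ transpositions fs

posT≗unsigned-transpose : ∀ {n} (i j : Fin n) → posT i j ≗ unsigned (transpose i j)
posT≗unsigned-transpose i j (s , k) with k ≟ i
... | yes _ = refl
... | no _ with k ≟ j
...   | yes _ = refl
...   | no _  = refl

πU≗unsigned-transpositions : ∀ {n} (fs : List (Fin n × Fin n)) → πU fs ≗ unsigned (transpositions fs)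
πU≗unsigned-transpositions []             x = refl
πU≗unsigned-transpositions ((a , b) ∷ fs) x =
  trans (cong (πU fs) (posT≗unsigned-transpose a b x)) (πU≗unsigned-transpositions fs _)

invT-self : ∀ {n} (i : Fin n) s → invT i (s , i) ≡ (not s , i)
invT-self i s with i ≟ i
... | yes _  = refl
... | no i≢i = ⊥-elim (i≢i refl)

invT-other : ∀ {n} (i : Fin n) {k} s → k ≢ i → invT i (s , k) ≡ (s , k)
invT-other i {k} s k≢i with k ≟ i
... | yes k≡i = ⊥-elim (k≢i k≡i)
... | no _    = refl

unsigned-invT : ∀ {n} (σ : Permutation′ n) (i : Fin n) →
                unsigned σ ∘ invT i ≗ invT (σ ⟨$⟩ʳ i) ∘ unsigned σ
unsigned-invT σ i (s , k) with k ≟ i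
... | yes refl = sym (invT-self (σ ⟨$⟩ʳ i) s)
... | no k≢i   = sym (invT-other (σ ⟨$⟩ʳ i) s (k≢i ∘ Injection.injective (↔⇒↣ σ)))

πU-invT : ∀ {n} (fs : List (Fin n × Fin n)) (i : Fin n) →
          πU fs ∘ invT i ≗ invT (transpositions fs ⟨$⟩ʳ i) ∘ πU fs
πU-invT fs i x = begin
  πU fs (invT i x)                 ≡⟨ πU≗unsigned-transpositions fs (invT i x) ⟩
  unsigned σ (invT i x)            ≡⟨ unsigned-invT σ i x ⟩
  invT (σ ⟨$⟩ʳ i) (unsigned σ x)   ≡⟨ cong (invT (σ ⟨$⟩ʳ i)) (πU≗unsigned-transpositions fs x) ⟨
  invT (σ ⟨$⟩ʳ i) (πU fs x)        ∎
  where σ = transpositions fs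

negT≗invT∘invT∘posT : ∀ {n} (i j : Fin n) → i ≢ j → negT i j ≗ invT i ∘ invT j ∘ posT i j
negT≗invT∘invT∘posT i j i≢j (s , k) with k ≟ i | k ≟ j
... | yes refl | _        = sym (trans (cong (invT i) (invT-self j s)) (invT-other i (not s) (i≢j ∘ sym)))
... | no _     | yes refl = sym (trans (cong (invT i) (invT-other j s i≢j)) (invT-self i s))
... | no k≢i   | no k≢j   = sym (trans (cong (invT i) (invT-other j s k≢j)) (invT-other i s k≢i))

invProd-++ : ∀ {n} (xs ys : List (Fin n)) → invProd (xs ++ ys) ≗ invProd xs ∘ invProd ys
invProd-++ []       ys x = refl
invProd-++ (i ∷ xs) ys x = cong (invT i) (invProd-++ xs ys x)

data IsLoop {n} : Edge n → Set where
  isLoop : ∀ i → IsLoop (loop i)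

isLoop? : ∀ {n} → Decidable (IsLoop {n})
isLoop? (pos _ _ _) = no λ ()
isLoop? (neg _ _ _) = no λ ()
isLoop? (loop i)    = yes (isLoop i)

inversionVertices : ∀ {n} → List (Edge n) → List (Fin n)
inversionVertices []               = []
inversionVertices (pos _ _ _ ∷ es) = inversionVertices es
inversionVertices (neg i j _ ∷ es) = inversionVertices es ++ ((σ ⟨$⟩ʳ i) ∷ (σ ⟨$⟩ʳ j) ∷ [])
  where σ = transpositions (φ es)
inversionVertices (loop i ∷ es)    = inversionVertices es ++ [ transpositions (φ es) ⟨$⟩ʳ i ]

πseq-factorisation : ∀ {n} (es : List (Edge n)) → πseq es ≗ invProd (inversionVertices es) ∘ πU (φ es)
πseq-factorisation []               x = refl
πseq-factorisation (pos i j _ ∷ es) x = πseq-factorisation es (posT i j x)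
πseq-factorisation (neg i j i<j ∷ es) x = begin
  πseq es (negT i j x)                             ≡⟨ cong (πseq es) (negT≗invT∘invT∘posT i j i≢j x) ⟩
  πseq es (invT i (invT j y))                      ≡⟨ πseq-factorisation es _ ⟩
  invProd vs (πU fs (invT i (invT j y)))           ≡⟨ cong (invProd vs) (πU-invT fs i _) ⟩
  invProd vs (invT (σ ⟨$⟩ʳ i) (πU fs (invT j y)))  ≡⟨ cong (invProd vs ∘ invT (σ ⟨$⟩ʳ i)) (πU-invT fs j y) ⟩
  invProd vs (invProd ws (πU fs y))                ≡⟨ invProd-++ vs ws _ ⟨
  invProd (vs ++ ws) (πU fs y)                     ∎
  where
  i≢j = <⇒≢ (recompute (i <? j) i<j)
  y   = posT i j x
  vs  = inversionVertices es
  fs  = φ es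
  σ   = transpositions fs
  ws  = (σ ⟨$⟩ʳ i) ∷ (σ ⟨$⟩ʳ j) ∷ []
πseq-factorisation (loop i ∷ es) x = begin
  πseq es (invT i x)                   ≡⟨ πseq-factorisation es (invT i x) ⟩
  invProd vs (πU fs (invT i x))        ≡⟨ cong (invProd vs) (πU-invT fs i x) ⟩
  invProd vs (invProd ws (πU fs x))    ≡⟨ invProd-++ vs ws _ ⟨
  invProd (vs ++ ws) (πU fs x)         ∎
  where
  vs = inversionVertices es
  fs = φ es
  ws = [ transpositions fs ⟨$⟩ʳ i ]

length-inversionVertices : ∀ {n} (es : List (Edge n)) →
  ∃[ k ] length (inversionVertices es) ≡ length (filter isLoop? es) + k * 2
length-inversionVertices [] = 0 , refl
length-inversionVertices (pos _ _ _ ∷ es) = length-inversionVertices es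
length-inversionVertices (neg i j _ ∷ es) with k , eq ← length-inversionVertices es = suc k , (begin
  length (vs ++ _)     ≡⟨ length-++ vs ⟩
  length vs + 2        ≡⟨ cong (_+ 2) eq ⟩
  l + k * 2 + 2        ≡⟨ +-assoc l (k * 2) 2 ⟩
  l + (k * 2 + 2)      ≡⟨ cong (l +_) (+-comm (k * 2) 2) ⟩
  l + suc k * 2        ∎)
  where
  vs = inversionVertices es
  l  = length (filter isLoop? es)
length-inversionVertices (loop i ∷ es) with k , eq ← length-inversionVertices es = k , (begin
  length (vs ++ _)     ≡⟨ length-++ vs ⟩
  length vs + 1        ≡⟨ +-comm (length vs) 1 ⟩
  suc (length vs)      ≡⟨ cong suc eq ⟩
  suc (l + k * 2)      ∎)
  where
  vs = inversionVertices es
  l  = length (filter isLoop? es)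

length-loops : ∀ {n} {G : SignedGraph n} (ω : EdgeOrdering G) → length (filter isLoop? (seq ω)) ≡ ∣ L G ∣
length-loops {G = G} ω = begin
  length (filter isLoop? (seq ω))   ≡⟨ unique∧set⇒length≡ (Unique.filter⁺ isLoop? (unique ω)) loops-unique loops-members ⟩
  length (map loop (members (L G))) ≡⟨ length-map loop (members (L G)) ⟩
  length (members (L G))            ≡⟨ length-members (L G) ⟩
  ∣ L G ∣                           ∎
  where
  loops-unique : Unique (map loop (members (L G)))
  loops-unique = Unique.map⁺ (λ { refl → refl }) (members-unique (L G))
  loops-members : ∀ {e} → (e ∈ filter isLoop? (seq ω)) ⇔ (e ∈ map loop (members (L G)))
  loops-members = mk⇔ to from
    where
    to : ∀ {e} → e ∈ filter isLoop? (seq ω) → e ∈ map loop (members (L G))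
    to q with ∈-filter⁻ isLoop? {xs = seq ω} q
    ... | e∈ω , isLoop i =
      ∈-map⁺ loop (Equivalence.from (∈-members (L G)) (Equivalence.to (complete ω (loop i)) e∈ω))
    from : ∀ {e} → e ∈ map loop (members (L G)) → e ∈ filter isLoop? (seq ω)
    from q with ∈-map⁻ loop q
    ... | i , i∈L , refl =
      ∈-filter⁺ isLoop? (Equivalence.from (complete ω (loop i)) (Equivalence.to (∈-members (L G)) i∈L)) (isLoop i)

lemma2p2 : (n : ℕ) (G : SignedGraph n) (ω : EdgeOrdering G) →
    ∃[ is ] ((∀ x → π ω x ≡ invProd is (πU (φ (seq ω)) x))
            × (length is % 2 ≡ ∣ L G ∣ % 2))
lemma2p2 n G ω = inversionVertices (seq ω) , πseq-factorisation (seq ω) , parity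
  where
  parity : length (inversionVertices (seq ω)) % 2 ≡ ∣ L G ∣ % 2
  parity with k , eq ← length-inversionVertices (seq ω) = begin
    length (inversionVertices (seq ω)) % 2  ≡⟨ cong (_% 2) eq ⟩
    (l + k * 2) % 2                         ≡⟨ [m+kn]%n≡m%n l k 2 ⟩
    l % 2                                   ≡⟨ cong (_% 2) (length-loops ω) ⟩
    ∣ L G ∣ % 2                             ∎
    where l = length (filter isLoop? (seq ω))
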